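{- Let $i\ge 1$ and $i+2\le s\le t\le r$ be integers, and let $\mathcal{H}$ be an $s$-graph with vertex set $V$ and $\Delta_i(\mathcal{H})\le\binom{r-i}{s-i}$. If for every $I\in\partial_i(\mathcal{H})$ the neighborhood $\mathcal{H}(I)$ is isomorphic to the complete $(s-i)$-graph $K^{(s-i)}_{r-i}$ on $r-i$ vertices, then $\mathcal{H}$ is a packing shadow $\partial_sP(i,r)$; that is, there is a family $\mathcal{A}$ of $r$-subsets of $V$, any two distinct members of which intersect in fewer than $i$ elements, such that $\mathcal{H}=\partial_s(\mathcal{A})$.
   Context: An $s$-graph is a finite vertex set $V$ with a set of $s$-subsets (edges). For $I\subseteq V$, $|I|=i$: $d_{\mathcal{H}}(I)$ is the number of edges containing $I$; $\Delta_i(\mathcal{H})=\max_{|I|=i}d_{\mathcal{H}}(I)$; the neighborhood $\mathcal{H}(I)$ is the $(s-i)$-graph with edge set $\{E\setminus I:I\subseteq E\in\mathcal{H}\}$ and vertex set the union of these edges. For a family $\mathcal{A}$ of sets of size at least $q$, $\partial_q(\mathcal{A})=\bigcup_{A\in\mathcal{A}}\binom{A}{q}$. An $i$-packing of $r$-sets ($P(i,r)$) is a family of $r$-sets covering each $i$-set at most once. -}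

module Defs where

open import Data.Nat using (ℕ; zero; suc; _≤_; _<_)
open import Data.Bool using (Bool; true; false; _∧_)
open import Data.List using (List; []; _∷_; _++_; map; length; filterᵇ)
open import Data.List.Membership.Propositional using () renaming (_∈_ to _∈ₗ_)
open import Data.Vec using (_∷_; [])
open import Data.Fin.Subset using (Subset; outside; inside; _⊆_; _∩_; _─_; ⋃; ∣_∣)
open import Data.Fin.Subset.Properties using (_⊆?_)
open import Data.Product using (Σ; _×_; ∃)
open import Relation.Nullary using (¬_; does)
open import Relation.Binary.PropositionalEquality using (_≡_; _≢_)
open import Data.Nat.Combinatorics using (_C_)

-- All subsets of Fin n (each exactly once).
allSubsets : (n : ℕ) → List (Subset n)
allSubsets zero = [] ∷ []
allSubsets (suc n) = map (outside ∷_) (allSubsets n) ++ map (inside ∷_) (allSubsets n)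

HGraph : ℕ → Set
HGraph n = Subset n → Bool

IsUniform : {n : ℕ} → ℕ → HGraph n → Set
IsUniform s H = ∀ E → H E ≡ true → ∣ E ∣ ≡ s

edgesContaining : {n : ℕ} → HGraph n → Subset n → List (Subset n)
edgesContaining {n} H I = filterᵇ (λ E → H E ∧ does (I ⊆? E)) (allSubsets n)

degree : {n : ℕ} → HGraph n → Subset n → ℕ
degree H I = length (edgesContaining H I)

MaxDegreeAtMost : {n : ℕ} → ℕ → HGraph n → ℕ → Set
MaxDegreeAtMost i H D = ∀ I → ∣ I ∣ ≡ i → degree H I ≤ D

InShadow : {n : ℕ} → ℕ → HGraph n → Subset n → Set
InShadow i H I = ∣ I ∣ ≡ i × ∃ λ E → H E ≡ true × I ⊆ E

NbrEdge : {n : ℕ} → HGraph n → Subset n → Subset n → Set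
NbrEdge H I F = ∃ λ E → H E ≡ true × I ⊆ E × F ≡ E ─ I

-- Vertex set of 𝓗(I): the union of its edges.
nbrVertices : {n : ℕ} → HGraph n → Subset n → Subset n
nbrVertices H I = ⋃ (map (λ E → E ─ I) (edgesContaining H I))

-- 𝓗(I) ≅ K^{(k)}_N : the vertex set of 𝓗(I) has exactly N elements and
-- the edges of 𝓗(I) are exactly the k-subsets of its vertex set.
NbrIsComplete : {n : ℕ} → HGraph n → Subset n → (k N : ℕ) → Set
NbrIsComplete H I k N =
  ∣ nbrVertices H I ∣ ≡ N ×
  (∀ F → NbrEdge H I F → F ⊆ nbrVertices H I × ∣ F ∣ ≡ k) ×
  (∀ F → F ⊆ nbrVertices H I → ∣ F ∣ ≡ k → NbrEdge H I F)

IsPacking : {n : ℕ} → ℕ → ℕ → List (Subset n) → Set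
IsPacking i r 𝓐 =
  (∀ A → A ∈ₗ 𝓐 → ∣ A ∣ ≡ r) ×
  (∀ A B → A ∈ₗ 𝓐 → B ∈ₗ 𝓐 → A ≢ B → ∣ A ∩ B ∣ < i)

InShadowOf : {n : ℕ} → ℕ → List (Subset n) → Subset n → Set
InShadowOf s 𝓐 E = ∣ E ∣ ≡ s × ∃ λ A → A ∈ₗ 𝓐 × E ⊆ A

{-# OPTIONS --safe #-}
-- For I ∈ ∂ᵢ𝓗 call block I = I ∪ V(𝓗(I)). Completeness of 𝓗(I) makes block I an
-- r-set whose s-subsets through I are exactly the edges through I. If K is an i-subset
-- of block I with |I ∪ K| < s, then extending I ∪ K, and I ∪ K ∪ {z} for z ∈ block I,
-- to s-subsets of block I gives edges through K, so K ∈ ∂ᵢ𝓗 and block I ⊆ block K,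
-- with equality since both have r elements. Since s ≥ i + 2, exchanging one element at
-- a time moves I to any i-subset K of block I along such steps, so block I = block K.
-- Hence distinct blocks share fewer than i elements, and an s-subset of a block is an
-- edge because it is an s-subset through one of its own i-subsets.
module Submission where

open import Defs
open import Data.Nat using (ℕ; zero; suc; _+_; _∸_; _≤_; _<_; z≤n; s≤s)
open import Data.Nat.Properties
open import Data.Nat.Combinatorics using (_C_)
open import Data.Bool using (true)
import Data.Bool as Bool
open import Data.Fin using (Fin)
open import Data.Fin.Subset
  using (Subset; _∈_; _∉_; _⊆_; _∪_; _∩_; _─_; ⁅_⁆; ⋃; ∣_∣; inside; outside; ⊥; Nonempty)
open import Data.Fin.Subset.Properties
open import Data.Vec.Base using ([]; _∷_; here; there)
open import Data.List using (List; []; _∷_; map; filter)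
import Data.List.Relation.Unary.Any as Any
open import Data.List.Membership.Propositional using () renaming (_∈_ to _∈ₗ_)
open import Data.List.Membership.Propositional.Properties
  using (∈-map⁺; ∈-map⁻; ∈-++⁺ˡ; ∈-++⁺ʳ; ∈-filter⁺; ∈-filter⁻)
open import Data.Product using (Σ; _×_; _,_; proj₁; proj₂; ∃)
open import Data.Sum using (inj₁; inj₂)
open import Data.Empty using (⊥-elim)
open import Relation.Nullary using (¬_; yes; no)
open import Relation.Nullary.Decidable using (_×-dec_)
open import Relation.Unary using (Decidable)
open import Relation.Binary.PropositionalEquality
  using (_≡_; _≢_; refl; sym; trans; cong; cong₂; subst; module ≡-Reasoning)

private
  variable
    n : ℕ
    x : Fin n
    p q r : Subset n

x∈p─q⇒x∉q : ∀ (p q : Subset n) → x ∈ p ─ q → x ∉ q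
x∈p─q⇒x∉q (inside  ∷ p) (outside ∷ q) here        ()
x∈p─q⇒x∉q (_       ∷ p) (_       ∷ q) (there x∈) (there x∈q) = x∈p─q⇒x∉q p q x∈ x∈q

¬Nonempty[p─q]⇒p⊆q : ¬ Nonempty (p ─ q) → p ⊆ q
¬Nonempty[p─q]⇒p⊆q {q = q} empty {x} x∈p with x ∈? q
... | yes x∈q = x∈q
... | no  x∉q = ⊥-elim (empty (x , x∈p∧x∉q⇒x∈p─q x∈p x∉q))

x∈p⇒⁅x⁆⊆p : x ∈ p → ⁅ x ⁆ ⊆ p
x∈p⇒⁅x⁆⊆p {x = x} {p = p} x∈p y∈⁅x⁆ = subst (_∈ p) (sym (x∈⁅y⁆⇒x≡y x y∈⁅x⁆)) x∈p

∪-least : p ⊆ r → q ⊆ r → p ∪ q ⊆ r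
∪-least {p = p} {q = q} p⊆r q⊆r x∈ with x∈p∪q⁻ p q x∈
... | inj₁ x∈p = p⊆r x∈p
... | inj₂ x∈q = q⊆r x∈q

─-cancelʳ-⊆ : r ⊆ q → p ─ r ≡ q ─ r → p ⊆ q
─-cancelʳ-⊆ {r = r} {p = p} r⊆q eq {x} x∈p with x ∈? r
... | yes x∈r = r⊆q x∈r
... | no  x∉r = p─q⊆p _ r (subst (x ∈_) eq (x∈p∧x∉q⇒x∈p─q x∈p x∉r))

─-cancelʳ : r ⊆ p → r ⊆ q → p ─ r ≡ q ─ r → p ≡ q
─-cancelʳ r⊆p r⊆q eq = ⊆-antisym (─-cancelʳ-⊆ r⊆q eq) (─-cancelʳ-⊆ r⊆p (sym eq))

x∈⋃⁻ : ∀ (ps : List (Subset n)) → x ∈ ⋃ ps → ∃ λ p → p ∈ₗ ps × x ∈ p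
x∈⋃⁻ []       x∈ = ⊥-elim (∉⊥ x∈)
x∈⋃⁻ (p ∷ ps) x∈ with x∈p∪q⁻ p (⋃ ps) x∈
... | inj₁ x∈p = p , Any.here refl , x∈p
... | inj₂ x∈⋃ = let (q , q∈ , x∈q) = x∈⋃⁻ ps x∈⋃ in q , Any.there q∈ , x∈q

∣p∪q∣≤∣p∣+∣q∣ : ∀ (p q : Subset n) → ∣ p ∪ q ∣ ≤ ∣ p ∣ + ∣ q ∣
∣p∪q∣≤∣p∣+∣q∣ []            []            = z≤n
∣p∪q∣≤∣p∣+∣q∣ (outside ∷ p) (outside ∷ q) = ∣p∪q∣≤∣p∣+∣q∣ p q
∣p∪q∣≤∣p∣+∣q∣ (outside ∷ p) (inside  ∷ q) =
  subst (suc ∣ p ∪ q ∣ ≤_) (sym (+-suc ∣ p ∣ ∣ q ∣)) (s≤s (∣p∪q∣≤∣p∣+∣q∣ p q))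
∣p∪q∣≤∣p∣+∣q∣ (inside  ∷ p) (outside ∷ q) = s≤s (∣p∪q∣≤∣p∣+∣q∣ p q)
∣p∪q∣≤∣p∣+∣q∣ (inside  ∷ p) (inside  ∷ q) =
  s≤s (≤-trans (∣p∪q∣≤∣p∣+∣q∣ p q) (+-monoʳ-≤ ∣ p ∣ (n≤1+n ∣ q ∣)))

∣p∪⁅x⁆∣≤1+∣p∣ : ∀ (p : Subset n) x → ∣ p ∪ ⁅ x ⁆ ∣ ≤ suc ∣ p ∣
∣p∪⁅x⁆∣≤1+∣p∣ p x = begin
  ∣ p ∪ ⁅ x ⁆ ∣       ≤⟨ ∣p∪q∣≤∣p∣+∣q∣ p ⁅ x ⁆ ⟩
  ∣ p ∣ + ∣ ⁅ x ⁆ ∣   ≡⟨ cong (∣ p ∣ +_) (∣⁅x⁆∣≡1 x) ⟩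
  ∣ p ∣ + 1           ≡⟨ +-comm ∣ p ∣ 1 ⟩
  suc ∣ p ∣           ∎
  where open ≤-Reasoning

∣p∪q∣≡∣p∣+∣q∣ : ∀ (p q : Subset n) → (∀ {x} → x ∈ p → x ∉ q) → ∣ p ∪ q ∣ ≡ ∣ p ∣ + ∣ q ∣
∣p∪q∣≡∣p∣+∣q∣ []            []            _        = refl
∣p∪q∣≡∣p∣+∣q∣ (outside ∷ p) (outside ∷ q) disjoint =
  ∣p∪q∣≡∣p∣+∣q∣ p q (λ x∈p x∈q → disjoint (there x∈p) (there x∈q))
∣p∪q∣≡∣p∣+∣q∣ (outside ∷ p) (inside  ∷ q) disjoint =
  trans (cong suc (∣p∪q∣≡∣p∣+∣q∣ p q (λ x∈p x∈q → disjoint (there x∈p) (there x∈q))))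
        (sym (+-suc ∣ p ∣ ∣ q ∣))
∣p∪q∣≡∣p∣+∣q∣ (inside  ∷ p) (outside ∷ q) disjoint =
  cong suc (∣p∪q∣≡∣p∣+∣q∣ p q (λ x∈p x∈q → disjoint (there x∈p) (there x∈q)))
∣p∪q∣≡∣p∣+∣q∣ (inside  ∷ p) (inside  ∷ q) disjoint = ⊥-elim (disjoint here here)

∣p─q∣+∣q∣≡∣p∣ : ∀ (p q : Subset n) → q ⊆ p → ∣ p ─ q ∣ + ∣ q ∣ ≡ ∣ p ∣
∣p─q∣+∣q∣≡∣p∣ []            []            _   = refl
∣p─q∣+∣q∣≡∣p∣ (outside ∷ p) (outside ∷ q) q⊆p = ∣p─q∣+∣q∣≡∣p∣ p q (drop-∷-⊆ q⊆p)
∣p─q∣+∣q∣≡∣p∣ (inside  ∷ p) (outside ∷ q) q⊆p = cong suc (∣p─q∣+∣q∣≡∣p∣ p q (drop-∷-⊆ q⊆p))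
∣p─q∣+∣q∣≡∣p∣ (inside  ∷ p) (inside  ∷ q) q⊆p =
  trans (+-suc ∣ p ─ q ∣ ∣ q ∣) (cong suc (∣p─q∣+∣q∣≡∣p∣ p q (drop-∷-⊆ q⊆p)))
∣p─q∣+∣q∣≡∣p∣ (outside ∷ p) (inside  ∷ q) q⊆p with () ← q⊆p here

p⊆q∧∣q∣≤∣p∣⇒p≡q : p ⊆ q → ∣ q ∣ ≤ ∣ p ∣ → p ≡ q
p⊆q∧∣q∣≤∣p∣⇒p≡q {p = p} p⊆q ∣q∣≤∣p∣ = ⊆-antisym p⊆q q⊆p
  where
  q⊆p : _ ⊆ p
  q⊆p {x} x∈q with x ∈? p
  ... | yes x∈p = x∈p
  ... | no  x∉p = ⊥-elim (<⇒≱ (p⊂q⇒∣p∣<∣q∣ (p⊆q , x , x∈q , x∉p)) ∣q∣≤∣p∣)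

∃-subset-between : ∀ (p q : Subset n) m → p ⊆ q → ∣ p ∣ ≤ m → m ≤ ∣ q ∣ →
                   ∃ λ r → p ⊆ r × r ⊆ q × ∣ r ∣ ≡ m
∃-subset-between []            []            zero    _   _   _ = [] , (λ ()) , (λ ()) , refl
∃-subset-between (outside ∷ p) (outside ∷ q) m p⊆q ∣p∣≤m m≤∣q∣ =
  let (r , p⊆r , r⊆q , ∣r∣≡m) = ∃-subset-between p q m (drop-∷-⊆ p⊆q) ∣p∣≤m m≤∣q∣
  in outside ∷ r , out⊆ p⊆r , out⊆ r⊆q , ∣r∣≡m
∃-subset-between (inside ∷ p) (inside ∷ q) (suc m) p⊆q (s≤s ∣p∣≤m) (s≤s m≤∣q∣) =
  let (r , p⊆r , r⊆q , ∣r∣≡m) = ∃-subset-between p q m (drop-∷-⊆ p⊆q) ∣p∣≤m m≤∣q∣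
  in inside ∷ r , in⊆in p⊆r , in⊆in r⊆q , cong suc ∣r∣≡m
∃-subset-between (outside ∷ p) (inside ∷ q) m p⊆q ∣p∣≤m m≤1+∣q∣ with m ≤? ∣ q ∣
... | yes m≤∣q∣ =
  let (r , p⊆r , r⊆q , ∣r∣≡m) = ∃-subset-between p q m (drop-∷-⊆ p⊆q) ∣p∣≤m m≤∣q∣
  in outside ∷ r , out⊆ p⊆r , out⊆ r⊆q , ∣r∣≡m
∃-subset-between (outside ∷ p) (inside ∷ q) zero    _   _ _           | no 0≰∣q∣ = ⊥-elim (0≰∣q∣ z≤n)
∃-subset-between (outside ∷ p) (inside ∷ q) (suc m) p⊆q _ (s≤s m≤∣q∣) | no m≰∣q∣ =
  -- here m = 1 + ∣q∣, so the bound on ∣p∣ comes from p ⊆ q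
  let ∣p∣≤m = ≤-trans (p⊆q⇒∣p∣≤∣q∣ (drop-∷-⊆ p⊆q)) (≤-pred (≰⇒> m≰∣q∣))
      (r , p⊆r , r⊆q , ∣r∣≡m) = ∃-subset-between p q m (drop-∷-⊆ p⊆q) ∣p∣≤m m≤∣q∣
  in inside ∷ r , out⊆ p⊆r , in⊆in r⊆q , cong suc ∣r∣≡m
∃-subset-between (inside ∷ p) (outside ∷ q) m p⊆q _ _ with () ← p⊆q here

∃-subset-of-size : ∀ (q : Subset n) m → m ≤ ∣ q ∣ → ∃ λ r → r ⊆ q × ∣ r ∣ ≡ m
∃-subset-of-size {n} q m m≤∣q∣ =
  let (r , _ , r⊆q , ∣r∣≡m) = ∃-subset-between ⊥ q m ⊥⊆ (subst (_≤ m) (sym (∣⊥∣≡0 n)) z≤n) m≤∣q∣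
  in r , r⊆q , ∣r∣≡m

∈-allSubsets : ∀ n (p : Subset n) → p ∈ₗ allSubsets n
∈-allSubsets zero    []            = Any.here refl
∈-allSubsets (suc n) (outside ∷ p) = ∈-++⁺ˡ (∈-map⁺ (outside ∷_) (∈-allSubsets n p))
∈-allSubsets (suc n) (inside ∷ p)  =
  ∈-++⁺ʳ (map (outside ∷_) (allSubsets n)) (∈-map⁺ (inside ∷_) (∈-allSubsets n p))

nbrVertices-disjoint : ∀ (H : HGraph n) I → x ∈ nbrVertices H I → x ∉ I
nbrVertices-disjoint H I x∈ x∈I =
  let (F , F∈ , x∈F) = x∈⋃⁻ (map (λ E → E ─ I) (edgesContaining H I)) x∈
      (E , _ , F≡E─I) = ∈-map⁻ (λ E → E ─ I) F∈
  in x∈p─q⇒x∉q E I (subst (_ ∈_) F≡E─I x∈F) x∈I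

module Blocks (i s r : ℕ) {n : ℕ} (H : HGraph n)
  (complete : ∀ I → InShadow i H I → NbrIsComplete H I (s ∸ i) (r ∸ i)) where

  block : Subset n → Subset n
  block I = I ∪ nbrVertices H I

  ∣block∣≡r : i ≤ r → ∀ {I} → InShadow i H I → ∣ block I ∣ ≡ r
  ∣block∣≡r i≤r {I} I∈∂ = begin
    ∣ I ∪ nbrVertices H I ∣         ≡⟨ ∣p∪q∣≡∣p∣+∣q∣ I _ (λ x∈I x∈N → nbrVertices-disjoint H I x∈N x∈I) ⟩
    ∣ I ∣ + ∣ nbrVertices H I ∣     ≡⟨ cong₂ _+_ (proj₁ I∈∂) (proj₁ (complete I I∈∂)) ⟩
    i + (r ∸ i)                     ≡⟨ m+[n∸m]≡n i≤r ⟩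
    r                               ∎
    where open ≡-Reasoning

  edge⊆block : ∀ {I E} → InShadow i H I → H E ≡ true → I ⊆ E → E ⊆ block I
  edge⊆block {I} {E} I∈∂ HE I⊆E {x} x∈E with x ∈? I
  ... | yes x∈I = p⊆p∪q _ x∈I
  ... | no  x∉I =
    let E─I⊆N = proj₁ (proj₁ (proj₂ (complete I I∈∂)) (E ─ I) (E , HE , I⊆E , refl))
    in q⊆p∪q I _ (E─I⊆N (x∈p∧x∉q⇒x∈p─q x∈E x∉I))

  ⊆block⇒edge : ∀ {I S} → InShadow i H I → I ⊆ S → S ⊆ block I → ∣ S ∣ ≡ s → H S ≡ true
  ⊆block⇒edge {I} {S} I∈∂ I⊆S S⊆block ∣S∣≡s =
    let (E , HE , I⊆E , S─I≡E─I) = proj₂ (proj₂ (complete I I∈∂)) (S ─ I) S─I⊆N ∣S─I∣≡s∸i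
    in subst (λ X → H X ≡ true) (sym (─-cancelʳ I⊆S I⊆E S─I≡E─I)) HE
    where
    S─I⊆N : S ─ I ⊆ nbrVertices H I
    S─I⊆N x∈ with x∈p∪q⁻ I _ (S⊆block (p─q⊆p S I x∈))
    ... | inj₁ x∈I = ⊥-elim (x∈p─q⇒x∉q S I x∈ x∈I)
    ... | inj₂ x∈N = x∈N

    ∣S─I∣≡s∸i : ∣ S ─ I ∣ ≡ s ∸ i
    ∣S─I∣≡s∸i = begin
      ∣ S ─ I ∣               ≡⟨ m+n∸n≡m ∣ S ─ I ∣ i ⟨
      ∣ S ─ I ∣ + i ∸ i       ≡⟨ cong (λ k → ∣ S ─ I ∣ + k ∸ i) (proj₁ I∈∂) ⟨
      ∣ S ─ I ∣ + ∣ I ∣ ∸ i   ≡⟨ cong (_∸ i) (trans (∣p─q∣+∣q∣≡∣p∣ S I I⊆S) ∣S∣≡s) ⟩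
      s ∸ i                   ∎
      where open ≡-Reasoning

  module BlockPacking (2+i≤s : 2 + i ≤ s) (s≤r : s ≤ r) where

    i≤s : i ≤ s
    i≤s = ≤-trans (m≤n+m i 2) 2+i≤s

    i≤r : i ≤ r
    i≤r = ≤-trans i≤s s≤r

    ⊆block⇒⊆edge : ∀ {I P} → InShadow i H I → I ⊆ P → P ⊆ block I → ∣ P ∣ ≤ s →
                   ∃ λ E → P ⊆ E × H E ≡ true
    ⊆block⇒⊆edge {I} {P} I∈∂ I⊆P P⊆block ∣P∣≤s =
      let s≤∣block∣ = subst (s ≤_) (sym (∣block∣≡r i≤r I∈∂)) s≤r
          (E , P⊆E , E⊆block , ∣E∣≡s) = ∃-subset-between P (block I) s P⊆block ∣P∣≤s s≤∣block∣
      in E , P⊆E , ⊆block⇒edge I∈∂ (⊆-trans I⊆P P⊆E) E⊆block ∣E∣≡s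

    block-shift : ∀ {I K} → InShadow i H I → K ⊆ block I → ∣ K ∣ ≡ i → ∣ I ∪ K ∣ < s →
                  InShadow i H K × block K ≡ block I
    block-shift {I} {K} I∈∂ K⊆block ∣K∣≡i ∣I∪K∣<s =
      K∈∂ , sym (p⊆q∧∣q∣≤∣p∣⇒p≡q block[I]⊆block[K] ∣block[K]∣≤∣block[I]∣)
      where
      I∪K⊆block : I ∪ K ⊆ block I
      I∪K⊆block = ∪-least (p⊆p∪q _) K⊆block

      K∈∂ : InShadow i H K
      K∈∂ =
        let (E , I∪K⊆E , HE) = ⊆block⇒⊆edge I∈∂ (p⊆p∪q K) I∪K⊆block (<⇒≤ ∣I∪K∣<s)
        in ∣K∣≡i , E , HE , ⊆-trans (q⊆p∪q I K) I∪K⊆E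

      block[I]⊆block[K] : block I ⊆ block K
      block[I]⊆block[K] {z} z∈block =
        let (E , P⊆E , HE) = ⊆block⇒⊆edge I∈∂ (⊆-trans (p⊆p∪q K) (p⊆p∪q ⁅ z ⁆))
                               (∪-least I∪K⊆block (x∈p⇒⁅x⁆⊆p z∈block))
                               (≤-trans (∣p∪⁅x⁆∣≤1+∣p∣ (I ∪ K) z) ∣I∪K∣<s)
        in edge⊆block K∈∂ HE (⊆-trans (q⊆p∪q I K) (⊆-trans (p⊆p∪q ⁅ z ⁆) P⊆E))
                        (P⊆E (q⊆p∪q (I ∪ K) ⁅ z ⁆ (x∈⁅x⁆ z)))

      ∣block[K]∣≤∣block[I]∣ : ∣ block K ∣ ≤ ∣ block I ∣
      ∣block[K]∣≤∣block[I]∣ = ≤-reflexive (trans (∣block∣≡r i≤r K∈∂) (sym (∣block∣≡r i≤r I∈∂)))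

    exchange : ∀ {I K y} → InShadow i H I → K ⊆ block I → ∣ K ∣ ≡ i → y ∈ K → y ∉ I →
               ∃ λ I′ → InShadow i H I′ × block I′ ≡ block I × ∣ K ─ I′ ∣ < ∣ K ─ I ∣
    exchange {I} {K} {y} I∈∂ K⊆block ∣K∣≡i y∈K y∉I =
      I′ , proj₁ shifted , proj₂ shifted ,
      p⊂q⇒∣p∣<∣q∣ (K─I′⊆K─I , y , x∈p∧x∉q⇒x∈p─q y∈K y∉I , λ y∈K─I′ → x∈p─q⇒x∉q K I′ y∈K─I′ y∈I′)
      where
      -- I′ keeps I ∩ K, gains y and stays inside I ∪ {y}, so |I ∪ I′| = i + 1.
      lower upper : Subset n
      lower = (I ∩ K) ∪ ⁅ y ⁆
      upper = I ∪ ⁅ y ⁆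

      ∣I∩K∣<i : ∣ I ∩ K ∣ < i
      ∣I∩K∣<i = subst (∣ I ∩ K ∣ <_) ∣K∣≡i
        (p⊂q⇒∣p∣<∣q∣ (p∩q⊆q I K , y , y∈K , λ y∈I∩K → y∉I (p∩q⊆p I K y∈I∩K)))

      i≤∣upper∣ : i ≤ ∣ upper ∣
      i≤∣upper∣ = subst (_≤ ∣ upper ∣) (proj₁ I∈∂) (∣p∣≤∣p∪q∣ I ⁅ y ⁆)

      picked : ∃ λ I′ → lower ⊆ I′ × I′ ⊆ upper × ∣ I′ ∣ ≡ i
      picked = ∃-subset-between lower upper i
        (∪-least (⊆-trans (p∩q⊆p I K) (p⊆p∪q ⁅ y ⁆)) (q⊆p∪q I ⁅ y ⁆))
        (≤-trans (∣p∪⁅x⁆∣≤1+∣p∣ (I ∩ K) y) ∣I∩K∣<i) i≤∣upper∣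

      I′ : Subset n
      I′ = proj₁ picked

      lower⊆I′ : lower ⊆ I′
      lower⊆I′ = proj₁ (proj₂ picked)

      I′⊆upper : I′ ⊆ upper
      I′⊆upper = proj₁ (proj₂ (proj₂ picked))

      y∈I′ : y ∈ I′
      y∈I′ = lower⊆I′ (q⊆p∪q (I ∩ K) ⁅ y ⁆ (x∈⁅x⁆ y))

      ∣I∪I′∣<s : ∣ I ∪ I′ ∣ < s
      ∣I∪I′∣<s = begin-strict
        ∣ I ∪ I′ ∣  ≤⟨ p⊆q⇒∣p∣≤∣q∣ (∪-least (p⊆p∪q ⁅ y ⁆) I′⊆upper) ⟩
        ∣ upper ∣   ≤⟨ ∣p∪⁅x⁆∣≤1+∣p∣ I y ⟩
        suc ∣ I ∣   ≡⟨ cong suc (proj₁ I∈∂) ⟩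
        suc i       <⟨ 2+i≤s ⟩
        s           ∎
        where open ≤-Reasoning

      shifted : InShadow i H I′ × block I′ ≡ block I
      shifted = block-shift I∈∂ (⊆-trans I′⊆upper (∪-least (p⊆p∪q _) (x∈p⇒⁅x⁆⊆p (K⊆block y∈K))))
                  (proj₂ (proj₂ (proj₂ picked))) ∣I∪I′∣<s

      K─I′⊆K─I : K ─ I′ ⊆ K ─ I
      K─I′⊆K─I {z} z∈K─I′ with z ∈? I
      ... | no  z∉I = x∈p∧x∉q⇒x∈p─q (p─q⊆p K I′ z∈K─I′) z∉I
      ... | yes z∈I = ⊥-elim (x∈p─q⇒x∉q K I′ z∈K─I′
                               (lower⊆I′ (p⊆p∪q ⁅ y ⁆ (x∈p∩q⁺ (z∈I , p─q⊆p K I′ z∈K─I′)))))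

    block-invariant : ∀ {I K} → InShadow i H I → K ⊆ block I → ∣ K ∣ ≡ i →
                      InShadow i H K × block K ≡ block I
    block-invariant {I} {K} I∈∂ K⊆block ∣K∣≡i = go ∣ K ─ I ∣ I∈∂ K⊆block ≤-refl
      where
      go : ∀ m {I} → InShadow i H I → K ⊆ block I → ∣ K ─ I ∣ ≤ m →
           InShadow i H K × block K ≡ block I
      go m {I} I∈∂ K⊆block _ with nonempty? (K ─ I)
      go m {I} I∈∂ K⊆block _ | no K─I-empty =
        block-shift I∈∂ K⊆block ∣K∣≡i (begin-strict
          ∣ I ∪ K ∣  ≤⟨ p⊆q⇒∣p∣≤∣q∣ (∪-least ⊆-refl (¬Nonempty[p─q]⇒p⊆q K─I-empty)) ⟩
          ∣ I ∣      ≡⟨ proj₁ I∈∂ ⟩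
          i          <⟨ ≤-trans (n≤1+n (suc i)) 2+i≤s ⟩
          s          ∎)
        where open ≤-Reasoning
      go zero    _   _        ∣K─I∣≤0   | yes (y , y∈K─I) =
        ⊥-elim (n≮0 (≤-trans (x∈p⇒∣p-x∣<∣p∣ y∈K─I) ∣K─I∣≤0))
      go (suc m) I∈∂ K⊆block ∣K─I∣≤1+m | yes (y , y∈K─I) =
        let (I′ , I′∈∂ , block[I′]≡block[I] , ∣K─I′∣<∣K─I∣) =
              exchange I∈∂ K⊆block ∣K∣≡i (p─q⊆p K _ y∈K─I) (x∈p─q⇒x∉q K _ y∈K─I)
            (K∈∂ , block[K]≡block[I′]) =
              go m I′∈∂ (subst (K ⊆_) (sym block[I′]≡block[I]) K⊆block)
                 (≤-pred (≤-trans ∣K─I′∣<∣K─I∣ ∣K─I∣≤1+m))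
        in K∈∂ , trans block[K]≡block[I′] block[I′]≡block[I]

    shadow? : Decidable (InShadow i H)
    shadow? I = (∣ I ∣ ≟ i) ×-dec anySubset? (λ E → (H E Bool.≟ true) ×-dec (I ⊆? E))

    blocks : List (Subset n)
    blocks = map block (filter shadow? (allSubsets n))

    ∈-blocks⁺ : ∀ {I} → InShadow i H I → block I ∈ₗ blocks
    ∈-blocks⁺ {I} I∈∂ = ∈-map⁺ block (∈-filter⁺ shadow? (∈-allSubsets n I) I∈∂)

    ∈-blocks⁻ : ∀ {X} → X ∈ₗ blocks → ∃ λ I → InShadow i H I × X ≡ block I
    ∈-blocks⁻ X∈ =
      let (I , I∈ , X≡block[I]) = ∈-map⁻ block X∈
      in I , proj₂ (∈-filter⁻ shadow? {xs = allSubsets n} I∈) , X≡block[I]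

    blocks-isPacking : IsPacking i r blocks
    blocks-isPacking = block-size , block-overlap
      where
      block-size : ∀ X → X ∈ₗ blocks → ∣ X ∣ ≡ r
      block-size X X∈ =
        let (I , I∈∂ , X≡block[I]) = ∈-blocks⁻ X∈
        in trans (cong ∣_∣ X≡block[I]) (∣block∣≡r i≤r I∈∂)

      block-overlap : ∀ X Y → X ∈ₗ blocks → Y ∈ₗ blocks → X ≢ Y → ∣ X ∩ Y ∣ < i
      block-overlap X Y X∈ Y∈ X≢Y with ∣ X ∩ Y ∣ <? i
      ... | yes ∣X∩Y∣<i = ∣X∩Y∣<i
      ... | no  ∣X∩Y∣≮i =
        let (I , I∈∂ , X≡block[I]) = ∈-blocks⁻ X∈
            (J , J∈∂ , Y≡block[J]) = ∈-blocks⁻ Y∈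
            (K , K⊆X∩Y , ∣K∣≡i) = ∃-subset-of-size (X ∩ Y) i (≮⇒≥ ∣X∩Y∣≮i)
            K⊆block[I] = ⊆-trans (⊆-trans K⊆X∩Y (p∩q⊆p X Y)) (⊆-reflexive X≡block[I])
            K⊆block[J] = ⊆-trans (⊆-trans K⊆X∩Y (p∩q⊆q X Y)) (⊆-reflexive Y≡block[J])
            (_ , block[K]≡block[I]) = block-invariant I∈∂ K⊆block[I] ∣K∣≡i
            (_ , block[K]≡block[J]) = block-invariant J∈∂ K⊆block[J] ∣K∣≡i
        in ⊥-elim (X≢Y (trans X≡block[I] (trans (sym block[K]≡block[I])
                                               (trans block[K]≡block[J] (sym Y≡block[J])))))

    edge⇒∈∂ₛ[blocks] : IsUniform s H → ∀ {E} → H E ≡ true → InShadowOf s blocks E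
    edge⇒∈∂ₛ[blocks] uniform {E} HE =
      let ∣E∣≡s = uniform E HE
          (I , I⊆E , ∣I∣≡i) = ∃-subset-of-size E i (subst (i ≤_) (sym ∣E∣≡s) i≤s)
          I∈∂ : InShadow i H I
          I∈∂ = ∣I∣≡i , E , HE , I⊆E
      in ∣E∣≡s , block I , ∈-blocks⁺ I∈∂ , edge⊆block I∈∂ HE I⊆E

    ∈∂ₛ[blocks]⇒edge : ∀ {E} → InShadowOf s blocks E → H E ≡ true
    ∈∂ₛ[blocks]⇒edge {E} (∣E∣≡s , X , X∈ , E⊆X) =
      let (I , I∈∂ , X≡block[I]) = ∈-blocks⁻ X∈
          E⊆block[I] = ⊆-trans E⊆X (⊆-reflexive X≡block[I])
          (K , K⊆E , ∣K∣≡i) = ∃-subset-of-size E i (subst (i ≤_) (sym ∣E∣≡s) i≤s)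
          (K∈∂ , block[K]≡block[I]) = block-invariant I∈∂ (⊆-trans K⊆E E⊆block[I]) ∣K∣≡i
      in ⊆block⇒edge K∈∂ K⊆E (⊆-trans E⊆block[I] (⊆-reflexive (sym block[K]≡block[I]))) ∣E∣≡s

lemma4p15 : (i s t r n : ℕ) → 1 ≤ i → i + 2 ≤ s → s ≤ t → t ≤ r →
    (H : HGraph n) → IsUniform s H →
    MaxDegreeAtMost i H ((r ∸ i) C (s ∸ i)) →
    (∀ I → InShadow i H I → NbrIsComplete H I (s ∸ i) (r ∸ i)) →
    Σ (List (Subset n)) λ 𝓐 → IsPacking i r 𝓐 ×
    (∀ E → (H E ≡ true → InShadowOf s 𝓐 E) × (InShadowOf s 𝓐 E → H E ≡ true))
lemma4p15 i s t r n _ i+2≤s s≤t t≤r H uniform _ complete =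
  blocks , blocks-isPacking , λ E → edge⇒∈∂ₛ[blocks] uniform , ∈∂ₛ[blocks]⇒edge
  where
  open Blocks i s r H complete
  open BlockPacking (subst (_≤ s) (+-comm i 2) i+2≤s) (≤-trans s≤t t≤r)
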